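{- Let $H=K_{k_1}\Box\cdots\Box K_{k_n}$ and let $G$ be an isometric daisy graph of $H$ with respect to $0^n$, where $H$ is the smallest possible. Then $E(G)$ has exactly $n$ $\triangle$-classes $F_1,\dots,F_n$, where for each $j\in\{1,\dots,n\}$ the class $F_j$ is the $\triangle$-class containing the edge $0^n e^j_i$ for some $0<i\le k_j-1$.
   Context: $V(H)=\prod_{i=1}^n\{0,\dots,k_i-1\}$, vertices adjacent iff they differ in exactly one coordinate; $e^j_i$ denotes the vertex $0^{j-1}\,i\,0^{n-j}$. The daisy graph $H_{0^n}(X)$ is the subgraph of $H$ induced by $\bigcup_{v\in X}I_H(0^n,v)$ ($I_H(a,b)$: vertices on shortest $a,b$-paths); isometric means distance-preserving. "$H$ is the smallest possible" means $G$ is not such a daisy graph of a Hamming graph with fewer or smaller factors (in particular every value of every coordinate is attained in $G$). For an edge $uv$, $W_{uv}=\{x\in V(G): d_G(u,x)<d_G(v,x)\}$; $uv\sim xy$ iff $x\in W_{uv}$ and $y\in W_{vu}$; $uv\,\triangle\,xy$ iff $uv\sim xy$ or there is a clique of $G$ containing edges $e,f$ with $xy\sim e$ and $uv\sim f$. In partial Hamming graphs $\triangle$ is an equivalence relation on edges; its classes are the $\triangle$-classes. -}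

module Defs where

open import Data.Nat using (ℕ; zero; suc; _+_; _<_; _≤_)
open import Data.Fin using (Fin)
open import Data.Vec using (Vec; lookup; replicate; _[_]≔_)
open import Data.Product using (Σ; ∃; ∃-syntax; _×_; _,_)
open import Data.Sum using (_⊎_)
open import Relation.Binary.PropositionalEquality using (_≡_; _≢_)
open import Relation.Nullary using (¬_)

data Walk {V : Set} (P : V → Set) (A : V → V → Set) : V → V → ℕ → Set where
  here : ∀ {u} → P u → Walk P A u u 0
  step : ∀ {u w v m} → P u → A u w → Walk P A w v m → Walk P A u v (suc m)

Dist : {V : Set} → (V → Set) → (V → V → Set) → V → V → ℕ → Set
Dist P A u v m = Walk P A u v m × (∀ m' → m' < m → ¬ Walk P A u v m')

-- Hamming graph H = K_{k_1} □ ... □ K_{k_n}; vertices are vectors of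
-- naturals whose j-th coordinate is < k_j.

Vertex : ℕ → Set
Vertex n = Vec ℕ n

InH : ∀ {n} → Vec ℕ n → Vertex n → Set
InH ks v = ∀ j → lookup v j < lookup ks j

HAdj : ∀ {n} → Vertex n → Vertex n → Set
HAdj u v = ∃[ j ] (lookup u j ≢ lookup v j × (∀ j' → j' ≢ j → lookup u j' ≡ lookup v j'))

dH : ∀ {n} → Vec ℕ n → Vertex n → Vertex n → ℕ → Set
dH ks = Dist (InH ks) HAdj

Interval : ∀ {n} → Vec ℕ n → Vertex n → Vertex n → Vertex n → Set
Interval ks a b x =
  InH ks x × ∃[ m ] ∃[ m₁ ] ∃[ m₂ ]
    (dH ks a b m × dH ks a x m₁ × dH ks x b m₂ × m₁ + m₂ ≡ m)

0ⁿ : ∀ {n} → Vertex n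
0ⁿ = replicate _ 0

e : ∀ {n} → Fin n → ℕ → Vertex n
e j i = 0ⁿ [ j ]≔ i

-- The daisy graph G = H_{0^n}(X): induced subgraph of H on the union of
-- the intervals I_H(0^n, v), v ∈ X.

InG : ∀ {n} → Vec ℕ n → (Vertex n → Set) → Vertex n → Set
InG ks X x = ∃[ v ] (X v × Interval ks 0ⁿ v x)

dG : ∀ {n} → Vec ℕ n → (Vertex n → Set) → Vertex n → Vertex n → ℕ → Set
dG ks X = Dist (InG ks X) HAdj

EdgeG : ∀ {n} → Vec ℕ n → (Vertex n → Set) → Vertex n → Vertex n → Set
EdgeG ks X u v = InG ks X u × InG ks X v × HAdj u v

Isometric : ∀ {n} → Vec ℕ n → (Vertex n → Set) → Set
Isometric ks X = ∀ u v m → InG ks X u → InG ks X v →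
  (dG ks X u v m → dH ks u v m) × (dH ks u v m → dG ks X u v m)

W : ∀ {n} → Vec ℕ n → (Vertex n → Set) → Vertex n → Vertex n → Vertex n → Set
W ks X u v x = ∃[ m ] ∃[ m' ] (dG ks X u x m × dG ks X v x m' × m < m')

SimO : ∀ {n} → Vec ℕ n → (Vertex n → Set) → Vertex n → Vertex n → Vertex n → Vertex n → Set
SimO ks X u v x y = W ks X u v x × W ks X v u y

-- ∼ on (unordered) edges: some orientation of xy works
Sim : ∀ {n} → Vec ℕ n → (Vertex n → Set) → Vertex n → Vertex n → Vertex n → Vertex n → Set
Sim ks X u v x y = SimO ks X u v x y ⊎ SimO ks X u v y x

EqOrAdj : ∀ {n} → Vertex n → Vertex n → Set
EqOrAdj u v = u ≡ v ⊎ HAdj u v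

Clique4 : ∀ {n} → Vec ℕ n → (Vertex n → Set) → Vertex n → Vertex n → Vertex n → Vertex n → Set
Clique4 ks X a b c d =
  InG ks X a × InG ks X b × InG ks X c × InG ks X d ×
  EqOrAdj a b × EqOrAdj a c × EqOrAdj a d ×
  EqOrAdj b c × EqOrAdj b d × EqOrAdj c d

Tri : ∀ {n} → Vec ℕ n → (Vertex n → Set) → Vertex n → Vertex n → Vertex n → Vertex n → Set
Tri ks X u v x y =
  Sim ks X u v x y ⊎
  (∃[ a ] ∃[ b ] ∃[ c ] ∃[ d ]
     (Clique4 ks X a b c d × EdgeG ks X a b × EdgeG ks X c d ×
      Sim ks X x y a b × Sim ks X u v c d))

-- H is the smallest possible: every factor is nontrivial and every value
-- of every coordinate is attained by a vertex of G.

Smallest : ∀ {n} → Vec ℕ n → (Vertex n → Set) → Set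
Smallest ks X =
  (∀ j → 2 ≤ lookup ks j) ×
  (∀ j i → i < lookup ks j → ∃[ x ] (InG ks X x × lookup x j ≡ i))

module Submission where

-- Since G is isometric, its distance is the Hamming distance.  Hence an
-- edge uv of G in direction p (the unique coordinate where u and v differ) has
-- W_uv = { x ∈ G | x_p = u_p }, so uv ∼ xy forces xy to have direction p as
-- well; a clique of H lies on a single line, so uv △ xy also forces equal
-- directions.  Conversely, as G is a union of intervals I_H(0ⁿ,v), projecting
-- a vertex of G onto the line of 0ⁿ in direction p stays inside G; two edges
-- of direction p, one of them on that line, are then △-related through the
-- clique formed by that edge and the projections of the other.  Minimality of
-- H puts e^p_1 into G, so the edges 0ⁿ e^p_1 represent one class per p.

open import Defs
open import Data.Nat using (ℕ; zero; suc; _+_; _<_; _≤_; z≤n; s≤s; _≟_)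
open import Data.Nat.Properties
open import Data.Fin using (Fin; zero; suc) renaming (_≟_ to _≟ᶠ_)
open import Data.Fin.Properties using () renaming (suc-injective to fsuc-injective)
open import Data.Vec using (Vec; []; _∷_; lookup; _[_]≔_)
open import Data.Vec.Properties using (lookup∘update; lookup∘update′; lookup-replicate)
open import Data.Vec.Relation.Binary.Pointwise.Extensional using (ext; Pointwise-≡⇒≡)
open import Data.Product using (Σ; ∃-syntax; _×_; _,_; proj₁; proj₂)
open import Data.Sum using (_⊎_; inj₁; inj₂)
open import Data.Empty using (⊥; ⊥-elim)
open import Function using (_∘_)
open import Relation.Nullary using (yes; no)
open import Relation.Nullary.Decidable using (decidable-stable)
open import Relation.Binary.Definitions using (tri<; tri≈; tri>)
open import Relation.Binary.PropositionalEquality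
open import Algebra.Properties.CommutativeSemigroup +-commutativeSemigroup
  using (interchange; xy∙z≈zy∙x)

private variable
  n m : ℕ
  p q : Fin n
  s t u v w x y : Vertex n

δ : ℕ → ℕ → ℕ
δ a b with a ≟ b
... | yes _ = 0
... | no _ = 1

δ-refl : ∀ a → δ a a ≡ 0
δ-refl a with a ≟ a
... | yes _ = refl
... | no a≢a = ⊥-elim (a≢a refl)

δ-≢ : ∀ {a b} → a ≢ b → δ a b ≡ 1
δ-≢ {a} {b} a≢b with a ≟ b
... | yes a≡b = ⊥-elim (a≢b a≡b)
... | no _ = refl

δ≤1 : ∀ a b → δ a b ≤ 1
δ≤1 a b with a ≟ b
... | yes _ = z≤n
... | no _ = s≤s z≤n

δ-triangle : ∀ a b c → δ a c ≤ δ a b + δ b c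
δ-triangle a b c with a ≟ b
... | yes refl = ≤-refl
... | no _ = ≤-trans (δ≤1 a c) (s≤s z≤n)

δ-between : ∀ {a b c} → b ≡ a ⊎ b ≡ c → δ a b + δ b c ≡ δ a c
δ-between {a} {c = c} (inj₁ refl) = cong (_+ δ a c) (δ-refl a)
δ-between {b = b} (inj₂ refl) = trans (cong (δ _ b +_) (δ-refl b)) (+-identityʳ _)

δ-between⁻ : ∀ a b c → δ a b + δ b c ≡ δ a c → b ≡ a ⊎ b ≡ c
δ-between⁻ a b c tight with a ≟ b | b ≟ c
... | yes a≡b | _ = inj₁ (sym a≡b)
... | no _ | yes b≡c = inj₂ b≡c
... | no _ | no _ = ⊥-elim (<⇒≱ (s≤s (s≤s z≤n)) (≤-trans (≤-reflexive tight) (δ≤1 a c)))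

+-tight : ∀ {a b a′ b′} → a ≤ a′ → b ≤ b′ → a′ + b′ ≡ a + b → a′ ≡ a × b′ ≡ b
+-tight {a} {b} {a′} {b′} a≤a′ b≤b′ eq = a′≡a , +-cancelˡ-≡ a b′ b (trans (cong (_+ b′) (sym a′≡a)) eq)
  where
  a′≡a : a′ ≡ a
  a′≡a = ≤-antisym (+-cancelʳ-≤ b′ a′ a (≤-trans (≤-reflexive eq) (+-monoʳ-≤ a b≤b′))) a≤a′

hamming : Vertex n → Vertex n → ℕ
hamming [] [] = 0
hamming (a ∷ u) (b ∷ v) = δ a b + hamming u v

hamming-refl : (u : Vertex n) → hamming u u ≡ 0
hamming-refl [] = refl
hamming-refl (a ∷ u) = cong₂ _+_ (δ-refl a) (hamming-refl u)

hamming-triangle : (s y t : Vertex n) → hamming s t ≤ hamming s y + hamming y t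
hamming-triangle [] [] [] = z≤n
hamming-triangle (a ∷ s) (b ∷ y) (c ∷ t) =
  ≤-trans (+-mono-≤ (δ-triangle a b c) (hamming-triangle s y t))
          (≤-reflexive (interchange (δ a b) (δ b c) (hamming s y) (hamming y t)))

Between : Vertex n → Vertex n → Vertex n → Set
Between s t y = ∀ i → lookup y i ≡ lookup s i ⊎ lookup y i ≡ lookup t i

hamming-between : (s t y : Vertex n) → Between s t y → hamming s y + hamming y t ≡ hamming s t
hamming-between [] [] [] _ = refl
hamming-between (a ∷ s) (c ∷ t) (b ∷ y) btw =
  trans (interchange (δ a b) (hamming s y) (δ b c) (hamming y t))
        (cong₂ _+_ (δ-between (btw zero)) (hamming-between s t y (btw ∘ suc)))

hamming-between⁻ : (s t y : Vertex n) → hamming s y + hamming y t ≡ hamming s t → Between s t y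
hamming-between⁻ (a ∷ s) (c ∷ t) (b ∷ y) tight =
  λ { zero → δ-between⁻ a b c (proj₁ split) ; (suc i) → hamming-between⁻ s t y (proj₂ split) i }
  where
  split : δ a b + δ b c ≡ δ a c × hamming s y + hamming y t ≡ hamming s t
  split = +-tight (δ-triangle a b c) (hamming-triangle s y t)
            (trans (sym (interchange (δ a b) (hamming s y) (δ b c) (hamming y t))) tight)

AgreeOff : Fin n → Vertex n → Vertex n → Set
AgreeOff p u w = ∀ j → j ≢ p → lookup u j ≡ lookup w j

-- uv is an edge of H in direction p; note HAdj u v is ∃[ p ] EdgeAt p u v.
EdgeAt : Fin n → Vertex n → Vertex n → Set
EdgeAt p u v = lookup u p ≢ lookup v p × AgreeOff p u v

AgreeOff-sym : AgreeOff p u v → AgreeOff p v u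
AgreeOff-sym agree j j≢p = sym (agree j j≢p)

EdgeAt-sym : EdgeAt p u v → EdgeAt p v u
EdgeAt-sym {u = u} {v = v} (u≢v , agree) = u≢v ∘ sym , AgreeOff-sym {u = u} {v = v} agree

AgreeOff-zero : ∀ {a c} → AgreeOff zero (a ∷ u) (c ∷ v) → u ≡ v
AgreeOff-zero agree = Pointwise-≡⇒≡ (ext (λ i → agree (suc i) (λ ())))

AgreeOff-suc : ∀ {a c} → AgreeOff (suc p) (a ∷ u) (c ∷ v) → AgreeOff p u v
AgreeOff-suc agree j j≢p = agree (suc j) (j≢p ∘ fsuc-injective)

hamming-shift : (p : Fin n) (u v x : Vertex n) → AgreeOff p u v →
  hamming u x + δ (lookup v p) (lookup x p) ≡ hamming v x + δ (lookup u p) (lookup x p)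
hamming-shift zero (a ∷ u) (c ∷ v) (b ∷ x) agree
  rewrite AgreeOff-zero agree = xy∙z≈zy∙x (δ a b) (hamming v x) (δ c b)
hamming-shift (suc p) (a ∷ u) (c ∷ v) (b ∷ x) agree rewrite agree zero (λ ()) = begin
  δ c b + hamming u x + δ (lookup v p) (lookup x p)   ≡⟨ +-assoc (δ c b) _ _ ⟩
  δ c b + (hamming u x + δ (lookup v p) (lookup x p)) ≡⟨ cong (δ c b +_) (hamming-shift p u v x (AgreeOff-suc agree)) ⟩
  δ c b + (hamming v x + δ (lookup u p) (lookup x p)) ≡⟨ +-assoc (δ c b) _ _ ⟨
  δ c b + hamming v x + δ (lookup u p) (lookup x p)   ∎
  where open ≡-Reasoning

hamming-step : (p : Fin n) (u w x : Vertex n) → AgreeOff p u w → hamming u x ≤ suc (hamming w x)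
hamming-step p u w x agree = begin
  hamming u x                                  ≤⟨ m≤m+n (hamming u x) _ ⟩
  hamming u x + δ (lookup w p) (lookup x p)    ≡⟨ hamming-shift p u w x agree ⟩
  hamming w x + δ (lookup u p) (lookup x p)    ≤⟨ +-monoʳ-≤ (hamming w x) (δ≤1 _ _) ⟩
  hamming w x + 1                              ≡⟨ +-comm (hamming w x) 1 ⟩
  suc (hamming w x)                            ∎
  where open ≤-Reasoning

hamming-closer : (p : Fin n) (u v x : Vertex n) → EdgeAt p u v →
  lookup x p ≡ lookup u p → hamming u x < hamming v x
hamming-closer p u v x (u≢v , agree) x≡u = begin
  suc (hamming u x)                            ≡⟨ +-comm 1 (hamming u x) ⟩
  hamming u x + 1                              ≡⟨ cong (hamming u x +_) (δ-≢ (λ v≡x → u≢v (trans (sym x≡u) (sym v≡x)))) ⟨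
  hamming u x + δ (lookup v p) (lookup x p)    ≡⟨ hamming-shift p u v x agree ⟩
  hamming v x + δ (lookup u p) (lookup x p)    ≡⟨ cong (λ a → hamming v x + δ (lookup u p) a) x≡u ⟩
  hamming v x + δ (lookup u p) (lookup u p)    ≡⟨ cong (hamming v x +_) (δ-refl (lookup u p)) ⟩
  hamming v x + 0                              ≡⟨ +-identityʳ (hamming v x) ⟩
  hamming v x                                  ∎
  where open ≤-Reasoning

hamming-not-closer : (p : Fin n) (u v x : Vertex n) → AgreeOff p u v →
  lookup u p ≢ lookup x p → hamming v x ≤ hamming u x
hamming-not-closer p u v x agree u≢x = +-cancelʳ-≤ 1 (hamming v x) (hamming u x) (begin
  hamming v x + 1                              ≡⟨ cong (hamming v x +_) (δ-≢ u≢x) ⟨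
  hamming v x + δ (lookup u p) (lookup x p)    ≡⟨ hamming-shift p u v x agree ⟨
  hamming u x + δ (lookup v p) (lookup x p)    ≤⟨ +-monoʳ-≤ (hamming u x) (δ≤1 _ _) ⟩
  hamming u x + 1                              ∎)
  where open ≤-Reasoning

hamming≤length : ∀ {V : Vertex n → Set} → Walk V HAdj u x m → hamming u x ≤ m
hamming≤length {u = u} (here _) = ≤-reflexive (hamming-refl u)
hamming≤length {x = x} (step {u = u} {w} _ (p , _ , agree) walk) =
  ≤-trans (hamming-step p u w x agree) (s≤s (hamming≤length walk))

InH-cons : ∀ {k} {ks : Vec ℕ n} {b} → b < k → InH ks u → InH (k ∷ ks) (b ∷ u)
InH-cons b<k u∈H zero = b<k
InH-cons b<k u∈H (suc i) = u∈H i

walk-cons : ∀ {k} {ks : Vec ℕ n} {b} → b < k →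
  Walk (InH ks) HAdj u x m → Walk (InH (k ∷ ks)) HAdj (b ∷ u) (b ∷ x) m
walk-cons b<k (here u∈H) = here (InH-cons b<k u∈H)
walk-cons {b = b} b<k (step {u = u} {w = w} u∈H (p , u≢w , agree) walk) =
  step (InH-cons b<k u∈H) (suc p , u≢w , agree′) (walk-cons b<k walk)
  where
  agree′ : AgreeOff (suc p) (b ∷ u) (b ∷ w)
  agree′ zero _ = refl
  agree′ (suc j) j≢p = agree j (j≢p ∘ cong suc)

-- A walk of H of length exactly the Hamming distance: fix one coordinate at a time.
geodesic : (ks : Vec ℕ n) (u x : Vertex n) → InH ks u → InH ks x →
  Walk (InH ks) HAdj u x (hamming u x)
geodesic [] [] [] u∈H _ = here u∈H
geodesic (k ∷ ks) (a ∷ u) (b ∷ x) u∈H x∈H with a ≟ b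
... | yes refl = walk-cons (x∈H zero) (geodesic ks u x (u∈H ∘ suc) (x∈H ∘ suc))
... | no a≢b = step u∈H (zero , a≢b , λ { zero 0≢0 → ⊥-elim (0≢0 refl) ; (suc j) _ → refl })
                 (walk-cons (x∈H zero) (geodesic ks u x (u∈H ∘ suc) (x∈H ∘ suc)))

dH-hamming : (ks : Vec ℕ n) → InH ks u → InH ks x → dH ks u x (hamming u x)
dH-hamming {u = u} {x} ks u∈H x∈H =
  geodesic ks u x u∈H x∈H , λ m′ m′<d walk → <⇒≱ m′<d (hamming≤length walk)

Dist-unique : ∀ {V : Set} {P : V → Set} {A : V → V → Set} {a b : V} {m m′} →
  Dist P A a b m → Dist P A a b m′ → m ≡ m′
Dist-unique {m = m} {m′} (walk , shortest) (walk′ , shortest′) with <-cmp m m′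
... | tri< m<m′ _ _ = ⊥-elim (shortest′ m m<m′ walk)
... | tri≈ _ m≡m′ _ = m≡m′
... | tri> _ _ m′<m = ⊥-elim (shortest m′ m′<m walk′)

walk-start : ∀ {V : Set} {P : V → Set} {A : V → V → Set} {a b : V} → Walk P A a b m → P a
walk-start (here a∈P) = a∈P
walk-start (step a∈P _ _) = a∈P

walk-end : ∀ {V : Set} {P : V → Set} {A : V → V → Set} {a b : V} → Walk P A a b m → P b
walk-end (here b∈P) = b∈P
walk-end (step _ _ walk) = walk-end walk

between⇒interval : (ks : Vec ℕ n) → InH ks s → InH ks t → InH ks y → Between s t y → Interval ks s t y
between⇒interval {s = s} {t} {y} ks s∈H t∈H y∈H btw =
  y∈H , hamming s t , hamming s y , hamming y t ,
  dH-hamming ks s∈H t∈H , dH-hamming ks s∈H y∈H , dH-hamming ks y∈H t∈H , hamming-between s t y btw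

interval⇒between : (ks : Vec ℕ n) → Interval ks s t y → Between s t y
interval⇒between {s = s} {t} {y} ks (y∈H , m , m₁ , m₂ , d , d₁ , d₂ , m₁+m₂≡m) =
  hamming-between⁻ s t y (begin
    hamming s y + hamming y t ≡⟨ cong₂ _+_ (Dist-unique d₁ (dH-hamming ks s∈H y∈H)) (Dist-unique d₂ (dH-hamming ks y∈H t∈H)) ⟨
    m₁ + m₂                   ≡⟨ m₁+m₂≡m ⟩
    m                         ≡⟨ Dist-unique d (dH-hamming ks s∈H t∈H) ⟩
    hamming s t               ∎)
  where
  open ≡-Reasoning
  s∈H = walk-start (proj₁ d)
  t∈H = walk-end (proj₁ d)

0ⁿ-InH : (ks : Vec ℕ n) → InH ks x → InH ks 0ⁿ
0ⁿ-InH ks x∈H i = subst (_< lookup ks i) (sym (lookup-replicate i 0)) (≤-<-trans z≤n (x∈H i))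

InH-between : (ks : Vec ℕ n) → InH ks s → InH ks t → Between s t y → InH ks y
InH-between ks s∈H t∈H btw i with btw i
... | inj₁ y≡s = subst (_< lookup ks i) (sym y≡s) (s∈H i)
... | inj₂ y≡t = subst (_< lookup ks i) (sym y≡t) (t∈H i)

update-agreeOff : (s : Vertex n) (p : Fin n) (a : ℕ) → AgreeOff p (s [ p ]≔ a) s
update-agreeOff s p a j j≢p = lookup∘update′ j≢p s a

line-edge : (s : Vertex n) → AgreeOff p x s → AgreeOff p y s → lookup x p ≢ lookup y p → EdgeAt p x y
line-edge _ x≈s y≈s x≢y = x≢y , λ j j≢p → trans (x≈s j j≢p) (sym (y≈s j j≢p))

line-clique : (s : Vertex n) → AgreeOff p x s → AgreeOff p y s → EqOrAdj x y
line-clique {p = p} {x = x} {y = y} s x≈s y≈s with lookup x p ≟ lookup y p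
... | no x≢y = inj₂ (p , line-edge {x = x} {y = y} s x≈s y≈s x≢y)
... | yes x≡y = inj₁ (Pointwise-≡⇒≡ (ext same))
  where
  same : ∀ i → lookup x i ≡ lookup y i
  same i with i ≟ᶠ p
  ... | yes refl = x≡y
  ... | no i≢p = trans (x≈s i i≢p) (sym (y≈s i i≢p))

between-project : (p : Fin n) → Between s t y → Between s t (s [ p ]≔ lookup y p)
between-project {s = s} {y = y} p btw i with i ≟ᶠ p
... | yes refl rewrite lookup∘update i s (lookup y i) = btw i
... | no i≢p = inj₁ (lookup∘update′ i≢p s (lookup y p))

direction-unique : lookup u p ≢ lookup v p → AgreeOff q u v → p ≡ q
direction-unique {p = p} {q = q} u≢v agree = decidable-stable (p ≟ᶠ q) (λ p≢q → u≢v (agree p p≢q))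

clique-on-line : EdgeAt p u v → EqOrAdj u w → EqOrAdj v w → AgreeOff p w u
clique-on-line _ (inj₁ refl) _ j _ = refl
clique-on-line {p = p} {u} {v} {w} (u≢v , uv) (inj₂ (r , u≢w , uw)) vw =
  subst (λ r → AgreeOff r w u) r≡p (AgreeOff-sym {u = u} {v = w} uw)
  where
  off-line : r ≢ p → EqOrAdj v w → ⊥
  off-line r≢p (inj₁ refl) = u≢w (uv r r≢p)
  off-line r≢p (inj₂ (r′ , _ , vw′)) = u≢v (trans (uw p p≢r) (sym (vw′ p p≢r′)))
    where
    r≡r′ : r ≡ r′
    r≡r′ = direction-unique {u = v} {v = w} (λ v≡w → u≢w (trans (uv r r≢p) v≡w)) vw′
    p≢r : p ≢ r
    p≢r = r≢p ∘ sym
    p≢r′ : p ≢ r′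
    p≢r′ p≡r′ = r≢p (trans r≡r′ (sym p≡r′))
  r≡p : r ≡ p
  r≡p = decidable-stable (r ≟ᶠ p) (λ r≢p → off-line r≢p vw)

module IsometricDaisy {n} (ks : Vec ℕ n) (X : Vertex n → Set)
  (X⊆H : ∀ v → X v → InH ks v) (isometric : Isometric ks X) where

  InG⇒InH : InG ks X x → InH ks x
  InG⇒InH (_ , _ , x∈H , _) = x∈H

  dG-hamming : InG ks X u → InG ks X x → dG ks X u x (hamming u x)
  dG-hamming {u = u} {x = x} u∈G x∈G =
    proj₂ (isometric u x (hamming u x) u∈G x∈G) (dH-hamming ks (InG⇒InH u∈G) (InG⇒InH x∈G))

  dG⇒hamming : dG ks X u x m → m ≡ hamming u x
  dG⇒hamming d = Dist-unique d (dG-hamming (walk-start (proj₁ d)) (walk-end (proj₁ d)))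

  W⇒same-side : EdgeAt p u v → W ks X u v x → lookup x p ≡ lookup u p
  W⇒same-side {p = p} {u = u} {v = v} {x = x} (_ , agree) (_ , _ , du , dv , closer) =
    decidable-stable (lookup x p ≟ lookup u p) λ x≢u →
      <⇒≱ (subst₂ _<_ (dG⇒hamming du) (dG⇒hamming dv) closer)
          (hamming-not-closer p u v x agree (x≢u ∘ sym))

  same-side⇒W : InG ks X u → InG ks X v → InG ks X x → EdgeAt p u v →
    lookup x p ≡ lookup u p → W ks X u v x
  same-side⇒W {u = u} {v = v} {x = x} {p = p} u∈G v∈G x∈G uv x≡u =
    hamming u x , hamming v x , dG-hamming u∈G x∈G , dG-hamming v∈G x∈G , hamming-closer p u v x uv x≡u

  sim⇒differ : EdgeAt p u v → Sim ks X u v x y → lookup x p ≢ lookup y p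
  sim⇒differ {u = u} {v = v} uv (inj₁ (x∈Wuv , y∈Wvu)) x≡y =
    proj₁ uv (trans (sym (W⇒same-side uv x∈Wuv)) (trans x≡y (W⇒same-side (EdgeAt-sym {u = u} {v = v} uv) y∈Wvu)))
  sim⇒differ {u = u} {v = v} uv (inj₂ (y∈Wuv , x∈Wvu)) x≡y =
    proj₁ uv (trans (sym (W⇒same-side uv y∈Wuv)) (trans (sym x≡y) (W⇒same-side (EdgeAt-sym {u = u} {v = v} uv) x∈Wvu)))

  -- △-related edges have the same direction: through a clique, both edges are
  -- ∼-related to edges of one line.
  tri⇒same-direction : EdgeAt p u v → EdgeAt q x y → Tri ks X u v x y → p ≡ q
  tri⇒same-direction {x = x} {y = y} uv xy (inj₁ uv∼xy) =
    direction-unique {u = x} {v = y} (sim⇒differ {x = x} {y = y} uv uv∼xy) (proj₂ xy)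
  tri⇒same-direction {q = q} uv xy
    (inj₂ (a , b , c , d , (_ , _ , _ , _ , _ , ac , ad , bc , bd , _) , (_ , _ , r , _ , ab) , _ , xy∼ab , uv∼cd)) =
    direction-unique {u = c} {v = d} (sim⇒differ {x = c} {y = d} uv uv∼cd) c≈d
    where
    a≢b : lookup a q ≢ lookup b q
    a≢b = sim⇒differ {x = a} {y = b} xy xy∼ab
    ab-q : EdgeAt q a b
    ab-q = a≢b , subst (λ r → AgreeOff r a b) (sym (direction-unique {u = a} {v = b} a≢b ab)) ab
    c≈d : AgreeOff q c d
    c≈d j j≢q = trans (clique-on-line ab-q ac bc j j≢q) (sym (clique-on-line ab-q ad bd j j≢q))

  -- G contains 0ⁿ and is closed under projection onto the lines through 0ⁿ,
  -- since 0ⁿ and the projection of x ∈ I(0ⁿ,v) again lie in I(0ⁿ,v).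
  InG-center : InG ks X x → InG ks X 0ⁿ
  InG-center (v , v∈X , _) = v , v∈X , between⇒interval ks 0∈H v∈H 0∈H (λ _ → inj₁ refl)
    where
    v∈H = X⊆H v v∈X
    0∈H = 0ⁿ-InH {x = v} ks v∈H

  InG-project : InG ks X x → (p : Fin n) → InG ks X (e p (lookup x p))
  InG-project {x = x} (v , v∈X , x∈I) p =
    v , v∈X , between⇒interval ks 0∈H v∈H (InH-between {s = 0ⁿ} {t = v} {y = e p (lookup x p)} ks 0∈H v∈H btw) btw
    where
    v∈H = X⊆H v v∈X
    0∈H = 0ⁿ-InH {x = v} ks v∈H
    btw : Between 0ⁿ v (e p (lookup x p))
    btw = between-project {s = 0ⁿ} {t = v} {y = x} p (interval⇒between ks x∈I)

  -- Two edges of G of direction p, the second on the line through 0ⁿ, are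
  -- △-related: the second edge and the projections of the first form a clique.
  same-direction⇒tri : InG ks X u → InG ks X v → InG ks X x → InG ks X y →
    EdgeAt p u v → EdgeAt p x y → AgreeOff p x 0ⁿ → AgreeOff p y 0ⁿ → Tri ks X u v x y
  same-direction⇒tri {u = u} {v = v} {x = x} {y = y} {p = p} u∈G v∈G x∈G y∈G uv xy x≈0 y≈0 =
    inj₂ (x , y , u′ , v′ , clique , (x∈G , y∈G , p , xy) , (u′∈G , v′∈G , p , u′v′) , xy∼xy , uv∼u′v′)
    where
    u′ v′ : Vertex n
    u′ = e p (lookup u p)
    v′ = e p (lookup v p)
    u′∈G = InG-project u∈G p
    v′∈G = InG-project v∈G p
    u′≈0 = update-agreeOff 0ⁿ p (lookup u p)
    v′≈0 = update-agreeOff 0ⁿ p (lookup v p)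
    u′-p : lookup u′ p ≡ lookup u p
    u′-p = lookup∘update p 0ⁿ (lookup u p)
    v′-p : lookup v′ p ≡ lookup v p
    v′-p = lookup∘update p 0ⁿ (lookup v p)
    u′v′ : EdgeAt p u′ v′
    u′v′ = line-edge {x = u′} {y = v′} 0ⁿ u′≈0 v′≈0
             (λ u′≡v′ → proj₁ uv (trans (sym u′-p) (trans u′≡v′ v′-p)))
    clique : Clique4 ks X x y u′ v′
    clique = x∈G , y∈G , u′∈G , v′∈G ,
             line-clique 0ⁿ x≈0 y≈0 , line-clique 0ⁿ x≈0 u′≈0 , line-clique 0ⁿ x≈0 v′≈0 ,
             line-clique 0ⁿ y≈0 u′≈0 , line-clique 0ⁿ y≈0 v′≈0 , line-clique 0ⁿ u′≈0 v′≈0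
    xy∼xy : Sim ks X x y x y
    xy∼xy = inj₁ (same-side⇒W x∈G y∈G x∈G xy refl ,
                  same-side⇒W y∈G x∈G y∈G (EdgeAt-sym {u = x} {v = y} xy) refl)
    uv∼u′v′ : Sim ks X u v u′ v′
    uv∼u′v′ = inj₁ (same-side⇒W u∈G v∈G u′∈G uv u′-p ,
                    same-side⇒W v∈G u∈G v′∈G (EdgeAt-sym {u = u} {v = v} uv) v′-p)

corollary3p4 : ∀ (n : ℕ) (ks : Vec ℕ n) (X : Vertex n → Set) →
    (∀ v → X v → InH ks v) →
    Isometric ks X →
    Smallest ks X →
    Σ (Fin n → ℕ) λ c →
    (∀ j → 0 < c j × c j < lookup ks j) ×
    (∀ j → EdgeG ks X 0ⁿ (e j (c j))) ×
    (∀ u v → EdgeG ks X u v → ∃[ j ] Tri ks X u v 0ⁿ (e j (c j))) ×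
    (∀ u v → EdgeG ks X u v → ∀ j j' →
    Tri ks X u v 0ⁿ (e j (c j)) → Tri ks X u v 0ⁿ (e j' (c j')) → j ≡ j')
corollary3p4 n ks X X⊆H isometric (nontrivial , attained) =
  (λ _ → 1) , (λ j → s≤s z≤n , nontrivial j) , edge , covered , separated
  where
  open IsometricDaisy ks X X⊆H isometric

  -- e^j_1 ∈ G: project a vertex of G whose j-th coordinate is 1.
  e₁∈G : ∀ j → InG ks X (e j 1)
  e₁∈G j with attained j 1 (nontrivial j)
  ... | x , x∈G , xⱼ≡1 = subst (λ a → InG ks X (e j a)) xⱼ≡1 (InG-project x∈G j)

  e₁≈0 : ∀ j → AgreeOff j (e j 1) 0ⁿ
  e₁≈0 j = update-agreeOff 0ⁿ j 1

  direction : ∀ j → EdgeAt j 0ⁿ (e j 1)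
  direction j = line-edge {x = 0ⁿ} {y = e j 1} 0ⁿ (λ _ _ → refl) (e₁≈0 j)
    (λ 0≡1 → 0≢1+n (trans (sym (lookup-replicate j 0)) (trans 0≡1 (lookup∘update j 0ⁿ 1))))

  edge : ∀ j → EdgeG ks X 0ⁿ (e j 1)
  edge j = InG-center (e₁∈G j) , e₁∈G j , j , direction j

  covered : ∀ u v → EdgeG ks X u v → ∃[ j ] Tri ks X u v 0ⁿ (e j 1)
  covered u v (u∈G , v∈G , p , uv) =
    p , same-direction⇒tri u∈G v∈G (InG-center u∈G) (e₁∈G p) uv (direction p) (λ _ _ → refl) (e₁≈0 p)

  separated : ∀ u v → EdgeG ks X u v → ∀ j j′ →
    Tri ks X u v 0ⁿ (e j 1) → Tri ks X u v 0ⁿ (e j′ 1) → j ≡ j′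
  separated u v (_ , _ , p , uv) j j′ uv△j uv△j′ =
    trans (sym (tri⇒same-direction uv (direction j) uv△j)) (tri⇒same-direction uv (direction j′) uv△j′)
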